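{- If a $B$-sequent $[\Gamma;\Psi;\Phi;\Delta]$ is valid, then it is derivable in the $B$-sequent calculus described in the context.
   Context: Language $\mathcal{S}$: formulas built from propositional variables with $\neg$, $\wedge$, $\vee$. Truth values $\mathbf{4}=\{\mathbf{f},\bot,\top,\mathbf{t}\}$ with truth order $\leq_t$: $\mathbf{f}$ least, $\mathbf{t}$ greatest, $\bot,\top$ incomparable in between; $-_t$ swaps $\mathbf{t},\mathbf{f}$ and fixes $\bot,\top$; $\sqcap_t,\sqcup_t$ meet and join. An agent is a map $s:\mathcal{S}\to\mathbf{4}$ with $s(\neg\varphi)=-_ts(\varphi)$, $s(\varphi\wedge\psi)=s(\varphi)\sqcap_ts(\psi)$, $s(\varphi\vee\psi)=s(\varphi)\sqcup_ts(\psi)$. $s$ accepts $\varphi$ iff $s(\varphi)\in\{\top,\mathbf{t}\}$, not-accepts iff $s(\varphi)\in\{\mathbf{f},\bot\}$, rejects iff $s(\varphi)\in\{\mathbf{f},\top\}$, not-rejects iff $s(\varphi)\in\{\bot,\mathbf{t}\}$. A $B$-sequent is a quadruple $[\Gamma;\Psi;\Phi;\Delta]$ of finite sets of formulas; it is valid iff there is no agent that accepts all of $\Gamma$, not-rejects all of $\Psi$, rejects all of $\Phi$ and not-accepts all of $\Delta$. Below "$\alpha,\Gamma$" means $\{\alpha\}\cup\Gamma$. Rules (premises $\Rightarrow$ conclusion): Initial: $[\{\alpha\};\emptyset;\emptyset;\{\alpha\}]$ and $[\emptyset;\{\alpha\};\{\alpha\};\emptyset]$. Weakening: from $[\Gamma;\Psi;\Phi;\Delta]$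 infer $[\Gamma\cup\Gamma';\Psi\cup\Psi';\Phi\cup\Phi';\Delta\cup\Delta']$. Cut$_t$: from $[\alpha,\Gamma;\Psi;\Phi;\Delta]$ and $[\Gamma;\Psi;\Phi;\Delta,\alpha]$ infer $[\Gamma;\Psi;\Phi;\Delta]$. Cut$_f$: from $[\Gamma;\alpha,\Psi;\Phi;\Delta]$ and $[\Gamma;\Psi;\Phi,\alpha;\Delta]$ infer $[\Gamma;\Psi;\Phi;\Delta]$. Conjunction: from $[\Gamma;\Psi;\Phi;\Delta,\alpha]$ and $[\Gamma;\Psi;\Phi;\Delta,\beta]$ infer $[\Gamma;\Psi;\Phi;\Delta,\alpha\wedge\beta]$; from $[\Gamma;\Psi;\Phi,\alpha;\Delta]$ and $[\Gamma;\Psi;\Phi,\beta;\Delta]$ infer $[\Gamma;\Psi;\Phi,\alpha\wedge\beta;\Delta]$; from $[\alpha,\beta,\Gamma;\Psi;\Phi;\Delta]$ infer $[\alpha\wedge\beta,\Gamma;\Psi;\Phi;\Delta]$; from $[\Gamma;\alpha,\beta,\Psi;\Phi;\Delta]$ infer $[\Gamma;\alpha\wedge\beta,\Psi;\Phi;\Delta]$. Disjunction: from $[\Gamma;\alpha,\Psi;\Phi;\Delta]$ and $[\Gamma;\beta,\Psi;\Phi;\Delta]$ infer $[\Gamma;\alpha\vee\beta,\Psi;\Phi;\Delta]$; from $[\alpha,\Gamma;\Psi;\Phi;\Delta]$ and $[\beta,\Gamma;\Psi;\Phi;\Delta]$ infer $[\alpha\vee\beta,\Gamma;\Psi;\Phi;\Delta]$;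 from $[\Gamma;\Psi;\Phi,\alpha,\beta;\Delta]$ infer $[\Gamma;\Psi;\Phi,\alpha\vee\beta;\Delta]$; from $[\Gamma;\Psi;\Phi;\Delta,\alpha,\beta]$ infer $[\Gamma;\Psi;\Phi;\Delta,\alpha\vee\beta]$. Negation: from $[\Gamma;\Psi;\Phi,\alpha;\Delta]$ infer $[\neg\alpha,\Gamma;\Psi;\Phi;\Delta]$; from $[\Gamma;\Psi;\Phi;\Delta,\alpha]$ infer $[\Gamma;\neg\alpha,\Psi;\Phi;\Delta]$; from $[\alpha,\Gamma;\Psi;\Phi;\Delta]$ infer $[\Gamma;\Psi;\Phi,\neg\alpha;\Delta]$; from $[\Gamma;\alpha,\Psi;\Phi;\Delta]$ infer $[\Gamma;\Psi;\Phi;\Delta,\neg\alpha]$. A $B$-sequent is derivable if it is the root of a finite tree built with these rules. -}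

module Defs where

open import Data.Nat using (ℕ)
open import Data.List using (List; []; _∷_; [_])
open import Data.List.Membership.Propositional using (_∈_)
open import Data.List.Relation.Binary.Subset.Propositional using (_⊆_)
open import Data.List.Relation.Unary.All using (All)
open import Data.Product using (_×_; Σ)
open import Relation.Binary.PropositionalEquality using (_≡_)
open import Relation.Nullary using (¬_)

data Form : Set where
  var  : ℕ → Form
  ¬'_  : Form → Form
  _∧'_ : Form → Form → Form
  _∨'_ : Form → Form → Form

infixr 6 _∧'_
infixr 5 _∨'_
infix 7 ¬'_

data Four : Set where
  𝐟 ⊥₄ ⊤₄ 𝐭 : Four

-t_ : Four → Four
-t 𝐟  = 𝐭
-t ⊥₄ = ⊥₄
-t ⊤₄ = ⊤₄
-t 𝐭  = 𝐟

-- meet in the truth order (f least, t greatest, ⊥ ⊤ incomparable)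
_⊓t_ : Four → Four → Four
𝐟  ⊓t y  = 𝐟
𝐭  ⊓t y  = y
⊥₄ ⊓t 𝐟  = 𝐟
⊥₄ ⊓t ⊥₄ = ⊥₄
⊥₄ ⊓t ⊤₄ = 𝐟
⊥₄ ⊓t 𝐭  = ⊥₄
⊤₄ ⊓t 𝐟  = 𝐟
⊤₄ ⊓t ⊥₄ = 𝐟
⊤₄ ⊓t ⊤₄ = ⊤₄
⊤₄ ⊓t 𝐭  = ⊤₄

_⊔t_ : Four → Four → Four
𝐭  ⊔t y  = 𝐭
𝐟  ⊔t y  = y
⊥₄ ⊔t 𝐭  = 𝐭
⊥₄ ⊔t ⊥₄ = ⊥₄
⊥₄ ⊔t ⊤₄ = 𝐭
⊥₄ ⊔t 𝐟  = ⊥₄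
⊤₄ ⊔t 𝐭  = 𝐭
⊤₄ ⊔t ⊥₄ = 𝐭
⊤₄ ⊔t ⊤₄ = ⊤₄
⊤₄ ⊔t 𝐟  = ⊤₄

record Agent : Set where
  field
    val  : Form → Four
    val¬ : ∀ φ → val (¬' φ) ≡ -t (val φ)
    val∧ : ∀ φ ψ → val (φ ∧' ψ) ≡ val φ ⊓t val ψ
    val∨ : ∀ φ ψ → val (φ ∨' ψ) ≡ val φ ⊔t val ψ
open Agent public

data IsAcc : Four → Set where
  acc⊤ : IsAcc ⊤₄
  acc𝐭 : IsAcc 𝐭

data IsRej : Four → Set where
  rej𝐟 : IsRej 𝐟
  rej⊤ : IsRej ⊤₄

Accepts NotAccepts Rejects NotRejects : Agent → Form → Set
Accepts    s φ = IsAcc (val s φ)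
NotAccepts s φ = ¬ IsAcc (val s φ)
Rejects    s φ = IsRej (val s φ)
NotRejects s φ = ¬ IsRej (val s φ)

-- Finite sets of formulas are represented by lists; only membership
-- matters (the Weakening rule with ⊆ gives reordering/contraction).
FSet : Set
FSet = List Form

record BSeq : Set where
  constructor [_⍮_⍮_⍮_]
  field
    Γ Ψ Φ Δ : FSet

Valid : BSeq → Set
Valid [ Γ ⍮ Ψ ⍮ Φ ⍮ Δ ] =
  ¬ Σ Agent (λ s → All (Accepts s) Γ × All (NotRejects s) Ψ
                 × All (Rejects s) Φ × All (NotAccepts s) Δ)

-- The B-sequent calculus ("α , Γ" is rendered as α ∷ Γ)
data Derivable : BSeq → Set where
  init₁ : ∀ α → Derivable [ [ α ] ⍮ [] ⍮ [] ⍮ [ α ] ]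
  init₂ : ∀ α → Derivable [ [] ⍮ [ α ] ⍮ [ α ] ⍮ [] ]
  weak  : ∀ {Γ Ψ Φ Δ Γ' Ψ' Φ' Δ'} →
          Γ ⊆ Γ' → Ψ ⊆ Ψ' → Φ ⊆ Φ' → Δ ⊆ Δ' →
          Derivable [ Γ ⍮ Ψ ⍮ Φ ⍮ Δ ] → Derivable [ Γ' ⍮ Ψ' ⍮ Φ' ⍮ Δ' ]
  cutₜ  : ∀ {Γ Ψ Φ Δ} α →
          Derivable [ α ∷ Γ ⍮ Ψ ⍮ Φ ⍮ Δ ] → Derivable [ Γ ⍮ Ψ ⍮ Φ ⍮ α ∷ Δ ] →
          Derivable [ Γ ⍮ Ψ ⍮ Φ ⍮ Δ ]
  cutf  : ∀ {Γ Ψ Φ Δ} α →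
          Derivable [ Γ ⍮ α ∷ Ψ ⍮ Φ ⍮ Δ ] → Derivable [ Γ ⍮ Ψ ⍮ α ∷ Φ ⍮ Δ ] →
          Derivable [ Γ ⍮ Ψ ⍮ Φ ⍮ Δ ]
  ∧Δ    : ∀ {Γ Ψ Φ Δ α β} →
          Derivable [ Γ ⍮ Ψ ⍮ Φ ⍮ α ∷ Δ ] → Derivable [ Γ ⍮ Ψ ⍮ Φ ⍮ β ∷ Δ ] →
          Derivable [ Γ ⍮ Ψ ⍮ Φ ⍮ (α ∧' β) ∷ Δ ]
  ∧Φ    : ∀ {Γ Ψ Φ Δ α β} →
          Derivable [ Γ ⍮ Ψ ⍮ α ∷ Φ ⍮ Δ ] → Derivable [ Γ ⍮ Ψ ⍮ β ∷ Φ ⍮ Δ ] →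
          Derivable [ Γ ⍮ Ψ ⍮ (α ∧' β) ∷ Φ ⍮ Δ ]
  ∧Γ    : ∀ {Γ Ψ Φ Δ α β} →
          Derivable [ α ∷ β ∷ Γ ⍮ Ψ ⍮ Φ ⍮ Δ ] →
          Derivable [ (α ∧' β) ∷ Γ ⍮ Ψ ⍮ Φ ⍮ Δ ]
  ∧Ψ    : ∀ {Γ Ψ Φ Δ α β} →
          Derivable [ Γ ⍮ α ∷ β ∷ Ψ ⍮ Φ ⍮ Δ ] →
          Derivable [ Γ ⍮ (α ∧' β) ∷ Ψ ⍮ Φ ⍮ Δ ]
  ∨Ψ    : ∀ {Γ Ψ Φ Δ α β} →
          Derivable [ Γ ⍮ α ∷ Ψ ⍮ Φ ⍮ Δ ] → Derivable [ Γ ⍮ β ∷ Ψ ⍮ Φ ⍮ Δ ] →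
          Derivable [ Γ ⍮ (α ∨' β) ∷ Ψ ⍮ Φ ⍮ Δ ]
  ∨Γ    : ∀ {Γ Ψ Φ Δ α β} →
          Derivable [ α ∷ Γ ⍮ Ψ ⍮ Φ ⍮ Δ ] → Derivable [ β ∷ Γ ⍮ Ψ ⍮ Φ ⍮ Δ ] →
          Derivable [ (α ∨' β) ∷ Γ ⍮ Ψ ⍮ Φ ⍮ Δ ]
  ∨Φ    : ∀ {Γ Ψ Φ Δ α β} →
          Derivable [ Γ ⍮ Ψ ⍮ α ∷ β ∷ Φ ⍮ Δ ] →
          Derivable [ Γ ⍮ Ψ ⍮ (α ∨' β) ∷ Φ ⍮ Δ ]
  ∨Δ    : ∀ {Γ Ψ Φ Δ α β} →
          Derivable [ Γ ⍮ Ψ ⍮ Φ ⍮ α ∷ β ∷ Δ ] →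
          Derivable [ Γ ⍮ Ψ ⍮ Φ ⍮ (α ∨' β) ∷ Δ ]
  ¬Γ    : ∀ {Γ Ψ Φ Δ α} →
          Derivable [ Γ ⍮ Ψ ⍮ α ∷ Φ ⍮ Δ ] → Derivable [ (¬' α) ∷ Γ ⍮ Ψ ⍮ Φ ⍮ Δ ]
  ¬Ψ    : ∀ {Γ Ψ Φ Δ α} →
          Derivable [ Γ ⍮ Ψ ⍮ Φ ⍮ α ∷ Δ ] → Derivable [ Γ ⍮ (¬' α) ∷ Ψ ⍮ Φ ⍮ Δ ]
  ¬Φ    : ∀ {Γ Ψ Φ Δ α} →
          Derivable [ α ∷ Γ ⍮ Ψ ⍮ Φ ⍮ Δ ] → Derivable [ Γ ⍮ Ψ ⍮ (¬' α) ∷ Φ ⍮ Δ ]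
  ¬Δ    : ∀ {Γ Ψ Φ Δ α} →
          Derivable [ Γ ⍮ α ∷ Ψ ⍮ Φ ⍮ Δ ] → Derivable [ Γ ⍮ Ψ ⍮ Φ ⍮ (¬' α) ∷ Δ ]

-- Read a four-valued truth value as a pair of independent classical bits,
-- "accepted" (⊤ or t) and "rejected" (f or ⊤): the truth meet acts as ∧ on
-- the first bit and as ∨ on the second, the join the other way round, and
-- negation swaps the bits.  Hence every rule of the calculus is semantically
-- invertible, so a valid sequent can be decomposed, one connective at a time,
-- into valid sequents of signed atoms.  Such a sequent must contain a pair
-- matching an initial sequent: otherwise setting the two bits of each atom p
-- to "p is in Γ" and "p is in Φ" yields a counter-agent.
module Submission where

open import Defs
open import Data.Bool using (Bool; true; false; T; if_then_else_)
open import Data.Empty using (⊥-elim)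
open import Data.List using (List; []; _∷_; _++_; map)
open import Data.List.Properties using (++-identityʳ)
open import Data.List.Membership.Propositional using (_∈_; find; lose)
open import Data.List.Membership.Propositional.Properties using (∈-map⁺; ∈-map⁻; ∈-++⁻)
open import Data.List.Relation.Binary.Subset.Propositional using (_⊆_)
open import Data.List.Relation.Binary.Permutation.Propositional using (↭-sym)
open import Data.List.Relation.Binary.Permutation.Propositional.Properties using (shift; ∈-resp-↭)
open import Data.List.Relation.Unary.All as All using (All; []; _∷_)
open import Data.List.Relation.Unary.All.Properties using (anti-mono; ++⁻; map⁺; map⁻)
open import Data.List.Relation.Unary.Any using (Any; here; there; any?)
open import Data.Nat using (ℕ)
import Data.Nat.Properties as ℕ
open import Data.Product using (_×_; _,_; proj₁; proj₂)
import Data.Product.Properties as Product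
open import Data.Sum using (_⊎_; inj₁; inj₂; [_,_]′)
open import Function using (_∘_)
open import Function.Bundles using (_⇔_; mk⇔; Equivalence)
open import Relation.Binary.Definitions using (DecidableEquality)
open import Relation.Binary.PropositionalEquality using (refl; subst)
open import Relation.Nullary using (¬_; Dec; yes; no; does)
open import Relation.Nullary.Decidable using (⌊_⌋; toWitness; fromWitness)
open Equivalence using (to; from)

isAcc-⊓ : ∀ a b → IsAcc (a ⊓t b) ⇔ (IsAcc a × IsAcc b)
isAcc-⊓ a b = mk⇔ (split a b) join
  where
  split : ∀ a b → IsAcc (a ⊓t b) → IsAcc a × IsAcc b
  split 𝐟  _  ()
  split ⊥₄ 𝐟  ()
  split ⊥₄ ⊥₄ ()
  split ⊥₄ ⊤₄ ()
  split ⊥₄ 𝐭  ()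
  split ⊤₄ 𝐟  ()
  split ⊤₄ ⊥₄ ()
  split ⊤₄ ⊤₄ _ = acc⊤ , acc⊤
  split ⊤₄ 𝐭  _ = acc⊤ , acc𝐭
  split 𝐭  _  p = acc𝐭 , p
  join : ∀ {a b} → IsAcc a × IsAcc b → IsAcc (a ⊓t b)
  join (acc⊤ , acc⊤) = acc⊤
  join (acc⊤ , acc𝐭) = acc⊤
  join (acc𝐭 , q)    = q

isRej-⊓ : ∀ a b → IsRej (a ⊓t b) ⇔ (IsRej a ⊎ IsRej b)
isRej-⊓ a b = mk⇔ (split a b) (join a b)
  where
  split : ∀ a b → IsRej (a ⊓t b) → IsRej a ⊎ IsRej b
  split 𝐟  _  _ = inj₁ rej𝐟
  split ⊥₄ 𝐟  _ = inj₂ rej𝐟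
  split ⊥₄ ⊥₄ ()
  split ⊥₄ ⊤₄ _ = inj₂ rej⊤
  split ⊥₄ 𝐭  ()
  split ⊤₄ _  _ = inj₁ rej⊤
  split 𝐭  _  r = inj₂ r
  join : ∀ a b → IsRej a ⊎ IsRej b → IsRej (a ⊓t b)
  join 𝐟  _  _                = rej𝐟
  join ⊥₄ 𝐟  _                = rej𝐟
  join ⊥₄ ⊤₄ _                = rej𝐟
  join ⊥₄ ⊥₄ (inj₁ ())
  join ⊥₄ ⊥₄ (inj₂ ())
  join ⊥₄ 𝐭  (inj₁ ())
  join ⊥₄ 𝐭  (inj₂ ())
  join ⊤₄ 𝐟  _                = rej𝐟
  join ⊤₄ ⊥₄ _                = rej𝐟
  join ⊤₄ ⊤₄ _                = rej⊤
  join ⊤₄ 𝐭  _                = rej⊤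
  join 𝐭  _  (inj₁ ())
  join 𝐭  _  (inj₂ r)         = r

isAcc-⊔ : ∀ a b → IsAcc (a ⊔t b) ⇔ (IsAcc a ⊎ IsAcc b)
isAcc-⊔ a b = mk⇔ (split a b) (join a b)
  where
  split : ∀ a b → IsAcc (a ⊔t b) → IsAcc a ⊎ IsAcc b
  split 𝐭  _  _ = inj₁ acc𝐭
  split 𝐟  _  p = inj₂ p
  split ⊥₄ 𝐭  _ = inj₂ acc𝐭
  split ⊥₄ ⊥₄ ()
  split ⊥₄ ⊤₄ _ = inj₂ acc⊤
  split ⊥₄ 𝐟  ()
  split ⊤₄ _  _ = inj₁ acc⊤
  join : ∀ a b → IsAcc a ⊎ IsAcc b → IsAcc (a ⊔t b)
  join 𝐭  _  _                = acc𝐭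
  join 𝐟  _  (inj₁ ())
  join 𝐟  _  (inj₂ p)         = p
  join ⊥₄ 𝐭  _                = acc𝐭
  join ⊥₄ ⊤₄ _                = acc𝐭
  join ⊥₄ ⊥₄ (inj₁ ())
  join ⊥₄ ⊥₄ (inj₂ ())
  join ⊥₄ 𝐟  (inj₁ ())
  join ⊥₄ 𝐟  (inj₂ ())
  join ⊤₄ 𝐭  _                = acc𝐭
  join ⊤₄ ⊥₄ _                = acc𝐭
  join ⊤₄ ⊤₄ _                = acc⊤
  join ⊤₄ 𝐟  _                = acc⊤

isRej-⊔ : ∀ a b → IsRej (a ⊔t b) ⇔ (IsRej a × IsRej b)
isRej-⊔ a b = mk⇔ (split a b) join
  where
  split : ∀ a b → IsRej (a ⊔t b) → IsRej a × IsRej b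
  split 𝐭  _  ()
  split ⊥₄ 𝐭  ()
  split ⊥₄ ⊥₄ ()
  split ⊥₄ ⊤₄ ()
  split ⊥₄ 𝐟  ()
  split ⊤₄ 𝐭  ()
  split ⊤₄ ⊥₄ ()
  split ⊤₄ ⊤₄ _ = rej⊤ , rej⊤
  split ⊤₄ 𝐟  _ = rej⊤ , rej𝐟
  split 𝐟  _  r = rej𝐟 , r
  join : ∀ {a b} → IsRej a × IsRej b → IsRej (a ⊔t b)
  join (rej⊤ , rej⊤) = rej⊤
  join (rej⊤ , rej𝐟) = rej⊤
  join (rej𝐟 , r)    = r

isAcc-neg : ∀ a → IsAcc (-t a) ⇔ IsRej a
isAcc-neg a = mk⇔ (split a) join
  where
  split : ∀ a → IsAcc (-t a) → IsRej a
  split 𝐟  _ = rej𝐟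
  split ⊥₄ ()
  split ⊤₄ _ = rej⊤
  split 𝐭  ()
  join : ∀ {a} → IsRej a → IsAcc (-t a)
  join rej𝐟 = acc𝐭
  join rej⊤ = acc⊤

isRej-neg : ∀ a → IsRej (-t a) ⇔ IsAcc a
isRej-neg a = mk⇔ (split a) join
  where
  split : ∀ a → IsRej (-t a) → IsAcc a
  split 𝐟  ()
  split ⊥₄ ()
  split ⊤₄ _ = acc⊤
  split 𝐭  _ = acc𝐭
  join : ∀ {a} → IsAcc a → IsRej (-t a)
  join acc⊤ = rej⊤
  join acc𝐭 = rej𝐟

module _ (s : Agent) (α β : Form) where

  accepts-∧ : Accepts s (α ∧' β) ⇔ (Accepts s α × Accepts s β)
  accepts-∧ rewrite val∧ s α β = isAcc-⊓ (val s α) (val s β)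

  rejects-∧ : Rejects s (α ∧' β) ⇔ (Rejects s α ⊎ Rejects s β)
  rejects-∧ rewrite val∧ s α β = isRej-⊓ (val s α) (val s β)

  accepts-∨ : Accepts s (α ∨' β) ⇔ (Accepts s α ⊎ Accepts s β)
  accepts-∨ rewrite val∨ s α β = isAcc-⊔ (val s α) (val s β)

  rejects-∨ : Rejects s (α ∨' β) ⇔ (Rejects s α × Rejects s β)
  rejects-∨ rewrite val∨ s α β = isRej-⊔ (val s α) (val s β)

accepts-¬ : ∀ s α → Accepts s (¬' α) ⇔ Rejects s α
accepts-¬ s α rewrite val¬ s α = isAcc-neg (val s α)

rejects-¬ : ∀ s α → Rejects s (¬' α) ⇔ Accepts s α
rejects-¬ s α rewrite val¬ s α = isRej-neg (val s α)

-- Sequents as lists of signed formulas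

data Sign : Set where
  inΓ inΨ inΦ inΔ : Sign

_≟_ : DecidableEquality Sign
inΓ ≟ inΓ = yes refl
inΓ ≟ inΨ = no λ ()
inΓ ≟ inΦ = no λ ()
inΓ ≟ inΔ = no λ ()
inΨ ≟ inΓ = no λ ()
inΨ ≟ inΨ = yes refl
inΨ ≟ inΦ = no λ ()
inΨ ≟ inΔ = no λ ()
inΦ ≟ inΓ = no λ ()
inΦ ≟ inΨ = no λ ()
inΦ ≟ inΦ = yes refl
inΦ ≟ inΔ = no λ ()
inΔ ≟ inΓ = no λ ()
inΔ ≟ inΨ = no λ ()
inΔ ≟ inΦ = no λ ()
inΔ ≟ inΔ = yes refl

SignedForm : Set
SignedForm = Sign × Form

component : Sign → BSeq → FSet
component inΓ = BSeq.Γ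
component inΨ = BSeq.Ψ
component inΦ = BSeq.Φ
component inΔ = BSeq.Δ

_⊨_ : Agent → SignedForm → Set
s ⊨ (inΓ , φ) = Accepts s φ
s ⊨ (inΨ , φ) = NotRejects s φ
s ⊨ (inΦ , φ) = Rejects s φ
s ⊨ (inΔ , φ) = NotAccepts s φ

formulas : Sign → List SignedForm → FSet
formulas g []            = []
formulas g ((h , φ) ∷ L) = if does (g ≟ h) then φ ∷ formulas g L else formulas g L

-- ⟦ (g , α) ∷ L ⟧ computes to a sequent with α at the head of its g-component,
-- so the rules of the calculus apply to it directly.
⟦_⟧ : List SignedForm → BSeq
⟦ L ⟧ = [ formulas inΓ L ⍮ formulas inΨ L ⍮ formulas inΦ L ⍮ formulas inΔ L ]

∈-formulas : ∀ g L {φ} → φ ∈ formulas g L ⇔ (g , φ) ∈ L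
∈-formulas g L = mk⇔ (out L) (into L)
  where
  out : ∀ L {φ} → φ ∈ formulas g L → (g , φ) ∈ L
  out ((h , _) ∷ L) m with g ≟ h | m
  ... | yes refl | here refl = here refl
  ... | yes refl | there m′  = there (out L m′)
  ... | no _     | m′        = there (out L m′)
  into : ∀ L {φ} → (g , φ) ∈ L → φ ∈ formulas g L
  into ((h , _) ∷ L) m with g ≟ h | m
  ... | yes refl | here refl = here refl
  ... | yes refl | there m′  = there (into L m′)
  ... | no g≢h   | here refl = ⊥-elim (g≢h refl)
  ... | no _     | there m′  = into L m′

formulas-⊆ : ∀ g {L L′} → L ⊆ L′ → formulas g L ⊆ formulas g L′
formulas-⊆ g {L} {L′} L⊆L′ = from (∈-formulas g L′) ∘ L⊆L′ ∘ to (∈-formulas g L)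

derivable-⊆ : ∀ {L L′} → L ⊆ L′ → Derivable ⟦ L ⟧ → Derivable ⟦ L′ ⟧
derivable-⊆ L⊆L′ =
  weak (formulas-⊆ inΓ L⊆L′) (formulas-⊆ inΨ L⊆L′) (formulas-⊆ inΦ L⊆L′) (formulas-⊆ inΔ L⊆L′)

-- A record rather than a function type, so that L is inferable from it.
record Unsatisfiable (L : List SignedForm) : Set where
  constructor unsatisfiable
  field refute : ∀ s → ¬ All (s ⊨_) L
open Unsatisfiable

unsatisfiable-antitone : ∀ {L L′} → (∀ s → All (s ⊨_) L′ → All (s ⊨_) L) →
                         Unsatisfiable L → Unsatisfiable L′
unsatisfiable-antitone entails u = unsatisfiable λ s → refute u s ∘ entails s

unsatisfiable-⊆ : ∀ {L L′} → L ⊆ L′ → Unsatisfiable L → Unsatisfiable L′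
unsatisfiable-⊆ L⊆L′ = unsatisfiable-antitone λ _ → anti-mono L⊆L′

unsatisfiable-replace-head : ∀ {x y L} → (∀ s → s ⊨ y → s ⊨ x) →
                             Unsatisfiable (x ∷ L) → Unsatisfiable (y ∷ L)
unsatisfiable-replace-head y⇒x = unsatisfiable-antitone λ { s (p ∷ ps) → y⇒x s p ∷ ps }

unsatisfiable-split-head : ∀ {x y z L} → (∀ s → s ⊨ y → s ⊨ z → s ⊨ x) →
                           Unsatisfiable (x ∷ L) → Unsatisfiable (y ∷ z ∷ L)
unsatisfiable-split-head yz⇒x =
  unsatisfiable-antitone λ { s (p ∷ q ∷ ps) → yz⇒x s p q ∷ ps }

-- Sequents of signed atoms

Literal : Set
Literal = Sign × ℕ

_≟ₗ_ : DecidableEquality Literal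
_≟ₗ_ = Product.≡-dec _≟_ ℕ._≟_

open import Data.List.Membership.DecPropositional _≟ₗ_ using (_∈?_)

literal : Literal → SignedForm
literal (g , p) = g , var p

conjugate : Sign → Sign
conjugate inΓ = inΔ
conjugate inΨ = inΦ
conjugate inΦ = inΨ
conjugate inΔ = inΓ

initial : ∀ g α → Derivable ⟦ (g , α) ∷ (conjugate g , α) ∷ [] ⟧
initial inΓ α = init₁ α
initial inΨ α = init₂ α
initial inΦ α = init₂ α
initial inΔ α = init₁ α

Clash : List Literal → Set
Clash ls = Any (λ (g , p) → (conjugate g , p) ∈ ls) ls

clash? : ∀ ls → Dec (Clash ls)
clash? ls = any? (λ (g , p) → (conjugate g , p) ∈? ls) ls

fromBits : Bool → Bool → Four
fromBits false false = ⊥₄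
fromBits false true  = 𝐟
fromBits true  false = 𝐭
fromBits true  true  = ⊤₄

isAcc-fromBits : ∀ a r → IsAcc (fromBits a r) ⇔ T a
isAcc-fromBits a r = mk⇔ (split a r) (join a r)
  where
  split : ∀ a r → IsAcc (fromBits a r) → T a
  split false false ()
  split false true  ()
  split true  _     _ = _
  join : ∀ a r → T a → IsAcc (fromBits a r)
  join true false _ = acc𝐭
  join true true  _ = acc⊤

isRej-fromBits : ∀ a r → IsRej (fromBits a r) ⇔ T r
isRej-fromBits a r = mk⇔ (split a r) (join a r)
  where
  split : ∀ a r → IsRej (fromBits a r) → T r
  split false false ()
  split true  false ()
  split _     true  _ = _
  join : ∀ a r → T r → IsRej (fromBits a r)
  join false true _ = rej𝐟
  join true  true _ = rej⊤

agentOf : (ℕ → Four) → Agent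
agentOf ρ = record
  { val = evaluate ; val¬ = λ _ → refl ; val∧ = λ _ _ → refl ; val∨ = λ _ _ → refl }
  where
  evaluate : Form → Four
  evaluate (var p)  = ρ p
  evaluate (¬' α)   = -t evaluate α
  evaluate (α ∧' β) = evaluate α ⊓t evaluate β
  evaluate (α ∨' β) = evaluate α ⊔t evaluate β

counterAgent : List Literal → Agent
counterAgent ls = agentOf λ p → fromBits ⌊ (inΓ , p) ∈? ls ⌋ ⌊ (inΦ , p) ∈? ls ⌋

counterAgent-⊨ : ∀ ls → ¬ Clash ls → ∀ {ℓ} → ℓ ∈ ls → counterAgent ls ⊨ literal ℓ
counterAgent-⊨ ls noClash {inΓ , p} ℓ∈ = from (isAcc-fromBits _ _) (fromWitness ℓ∈)
counterAgent-⊨ ls noClash {inΦ , p} ℓ∈ = from (isRej-fromBits _ _) (fromWitness ℓ∈)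
counterAgent-⊨ ls noClash {inΔ , p} ℓ∈ accepted =
  noClash (lose (toWitness (to (isAcc-fromBits _ _) accepted)) ℓ∈)
counterAgent-⊨ ls noClash {inΨ , p} ℓ∈ rejected =
  noClash (lose (toWitness (to (isRej-fromBits _ _) rejected)) ℓ∈)

Complete : List SignedForm → Set
Complete R = ∀ ls → Unsatisfiable (R ++ map literal ls) → Derivable ⟦ R ++ map literal ls ⟧

complete-literals : Complete []
complete-literals ls u with clash? ls
... | yes clash with find clash
...   | (g , p) , ℓ∈ , ℓ̄∈ = derivable-⊆ pair⊆ls (initial g (var p))
  where
  pair⊆ls : (g , var p) ∷ (conjugate g , var p) ∷ [] ⊆ map literal ls
  pair⊆ls (here refl)         = ∈-map⁺ literal ℓ∈
  pair⊆ls (there (here refl)) = ∈-map⁺ literal ℓ̄∈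
complete-literals ls u | no noClash =
  ⊥-elim (refute u (counterAgent ls) (map⁺ (All.tabulate (counterAgent-⊨ ls noClash))))

-- Recursion is on φ alone: where a rule adds two formulas, the hypothesis for
-- the longer tail is itself obtained by a recursive call on the second one.
complete-∷ : ∀ g φ R → Complete R → Complete ((g , φ) ∷ R)
complete-∷ g (var p) R ih ls u =
  derivable-⊆ (∈-resp-↭ moveLiteral)
    (ih ((g , p) ∷ ls) (unsatisfiable-⊆ (∈-resp-↭ (↭-sym moveLiteral)) u))
  where moveLiteral = shift (g , var p) R (map literal ls)
complete-∷ inΓ (α ∧' β) R ih ls u =
  ∧Γ (complete-∷ inΓ α ((inΓ , β) ∷ R) (complete-∷ inΓ β R ih) ls
       (unsatisfiable-split-head (λ s p q → from (accepts-∧ s α β) (p , q)) u))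
complete-∷ inΓ (α ∨' β) R ih ls u =
  ∨Γ (complete-∷ inΓ α R ih ls
       (unsatisfiable-replace-head (λ s p → from (accepts-∨ s α β) (inj₁ p)) u))
     (complete-∷ inΓ β R ih ls
       (unsatisfiable-replace-head (λ s q → from (accepts-∨ s α β) (inj₂ q)) u))
complete-∷ inΓ (¬' α) R ih ls u =
  ¬Γ (complete-∷ inΦ α R ih ls
       (unsatisfiable-replace-head (λ s → from (accepts-¬ s α)) u))
complete-∷ inΨ (α ∧' β) R ih ls u =
  ∧Ψ (complete-∷ inΨ α ((inΨ , β) ∷ R) (complete-∷ inΨ β R ih) ls
       (unsatisfiable-split-head (λ s p q r → [ p , q ]′ (to (rejects-∧ s α β) r)) u))
complete-∷ inΨ (α ∨' β) R ih ls u =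
  ∨Ψ (complete-∷ inΨ α R ih ls
       (unsatisfiable-replace-head (λ s p r → p (proj₁ (to (rejects-∨ s α β) r))) u))
     (complete-∷ inΨ β R ih ls
       (unsatisfiable-replace-head (λ s q r → q (proj₂ (to (rejects-∨ s α β) r))) u))
complete-∷ inΨ (¬' α) R ih ls u =
  ¬Ψ (complete-∷ inΔ α R ih ls
       (unsatisfiable-replace-head (λ s p r → p (to (rejects-¬ s α) r)) u))
complete-∷ inΦ (α ∧' β) R ih ls u =
  ∧Φ (complete-∷ inΦ α R ih ls
       (unsatisfiable-replace-head (λ s p → from (rejects-∧ s α β) (inj₁ p)) u))
     (complete-∷ inΦ β R ih ls
       (unsatisfiable-replace-head (λ s q → from (rejects-∧ s α β) (inj₂ q)) u))
complete-∷ inΦ (α ∨' β) R ih ls u =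
  ∨Φ (complete-∷ inΦ α ((inΦ , β) ∷ R) (complete-∷ inΦ β R ih) ls
       (unsatisfiable-split-head (λ s p q → from (rejects-∨ s α β) (p , q)) u))
complete-∷ inΦ (¬' α) R ih ls u =
  ¬Φ (complete-∷ inΓ α R ih ls
       (unsatisfiable-replace-head (λ s → from (rejects-¬ s α)) u))
complete-∷ inΔ (α ∧' β) R ih ls u =
  ∧Δ (complete-∷ inΔ α R ih ls
       (unsatisfiable-replace-head (λ s p a → p (proj₁ (to (accepts-∧ s α β) a))) u))
     (complete-∷ inΔ β R ih ls
       (unsatisfiable-replace-head (λ s q a → q (proj₂ (to (accepts-∧ s α β) a))) u))
complete-∷ inΔ (α ∨' β) R ih ls u =
  ∨Δ (complete-∷ inΔ α ((inΔ , β) ∷ R) (complete-∷ inΔ β R ih) ls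
       (unsatisfiable-split-head (λ s p q a → [ p , q ]′ (to (accepts-∨ s α β) a)) u))
complete-∷ inΔ (¬' α) R ih ls u =
  ¬Δ (complete-∷ inΨ α R ih ls
       (unsatisfiable-replace-head (λ s p a → p (to (accepts-¬ s α) a)) u))

complete : ∀ R → Complete R
complete []            = complete-literals
complete ((g , φ) ∷ R) = complete-∷ g φ R (complete R)

unsatisfiable⇒derivable : ∀ L → Unsatisfiable L → Derivable ⟦ L ⟧
unsatisfiable⇒derivable L =
  subst (λ L → Unsatisfiable L → Derivable ⟦ L ⟧) (++-identityʳ L) (complete L [])

signed : BSeq → List SignedForm
signed [ Γ ⍮ Ψ ⍮ Φ ⍮ Δ ] = map (inΓ ,_) Γ ++ map (inΨ ,_) Ψ ++ map (inΦ ,_) Φ ++ map (inΔ ,_) Δ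

∈-tagged⁻ : ∀ S {h g φ} → (g , φ) ∈ map (h ,_) (component h S) → φ ∈ component g S
∈-tagged⁻ S {h} m with ∈-map⁻ (h ,_) m
... | _ , φ∈ , refl = φ∈

∈-signed⁻ : ∀ S {g φ} → (g , φ) ∈ signed S → φ ∈ component g S
∈-signed⁻ S@([ Γ ⍮ Ψ ⍮ Φ ⍮ Δ ]) m with ∈-++⁻ (map (inΓ ,_) Γ) m
... | inj₁ mΓ = ∈-tagged⁻ S mΓ
... | inj₂ m′ with ∈-++⁻ (map (inΨ ,_) Ψ) m′
...   | inj₁ mΨ = ∈-tagged⁻ S mΨ
...   | inj₂ m″ with ∈-++⁻ (map (inΦ ,_) Φ) m″
...     | inj₁ mΦ = ∈-tagged⁻ S mΦ
...     | inj₂ mΔ = ∈-tagged⁻ S mΔ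

derivable-signed : ∀ S → Derivable ⟦ signed S ⟧ → Derivable S
derivable-signed S = weak (from-signed inΓ) (from-signed inΨ) (from-signed inΦ) (from-signed inΔ)
  where
  from-signed : ∀ g → formulas g (signed S) ⊆ component g S
  from-signed g = ∈-signed⁻ S ∘ to (∈-formulas g (signed S))

unsatisfiable-signed : ∀ S → Valid S → Unsatisfiable (signed S)
unsatisfiable-signed [ Γ ⍮ Ψ ⍮ Φ ⍮ Δ ] valid = unsatisfiable λ s all₀ →
  let all-Γ , all₁ = ++⁻ (map (inΓ ,_) Γ) all₀
      all-Ψ , all₂ = ++⁻ (map (inΨ ,_) Ψ) all₁
      all-Φ , all-Δ = ++⁻ (map (inΦ ,_) Φ) all₂
  in valid (s , map⁻ all-Γ , map⁻ all-Ψ , map⁻ all-Φ , map⁻ all-Δ)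

mainTheorem5 : ∀ Γ Ψ Φ Δ → Valid [ Γ ⍮ Ψ ⍮ Φ ⍮ Δ ] → Derivable [ Γ ⍮ Ψ ⍮ Φ ⍮ Δ ]
mainTheorem5 Γ Ψ Φ Δ valid =
  derivable-signed S (unsatisfiable⇒derivable (signed S) (unsatisfiable-signed S valid))
  where S = [ Γ ⍮ Ψ ⍮ Φ ⍮ Δ ]
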